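{- Let $\mathcal{M}$ be the set of ternary Motzkin words, ordered first by length and then, among words of equal length, lexicographically with $0<1<2$; for $w\in\mathcal{M}$ that is not the largest word of its length, let $\mathrm{Succ}(w)$ be the next word of $\mathcal{M}$ in this order. Let $w\in\mathcal{M}$ with $w=p\cdot s$ (concatenation), where $p$ is a nonempty string and $s$ is a string of one of the following forms (with $k,l\ge 0$ integers, $x^j$ denoting $j$-fold repetition of the string $x$). Then $\mathrm{Succ}(w)=p\cdot s'$, where $s'$ is given as follows: (i) if $s=0\,2^k$ with $k\ge1$, then $s'=2\,0\,2^{k-1}$; (ii) if $s=0\,2^k(12)^l$ with $l\ge1$, then $s'=1\,0^{2l-1}\,2^{k+1}$; (iii) if $s=1\,2^k(12)^l$ with $k\ge2$, then $s'=2\,0^{2l+2}\,2^{k-2}$; (iv) if $s=0\,2^k(12)^l\,0$ with $k+l\ge1$, then $s'=1\,0^{2l}\,2^{k+1}$; (v) if $s=1\,2^k(12)^l\,0$ with $k\ge2$, then $s'=2\,0^{2l+3}\,2^{k-2}$.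
   Context: A ternary Motzkin word is a string over the alphabet $\{0,1,2\}$ with equally many $1$'s and $2$'s in which every prefix contains at least as many $1$'s as $2$'s (equivalently, every suffix contains at most as many $1$'s as $2$'s). The set $\mathcal{M}$ of ternary Motzkin words consists of the word $0$ together with all nonempty such strings whose first character is $1$ (words differing only by leading zeros are identified). Strings are written by concatenation, e.g. $1\,0^3\,2=10002$. -}

module Defs where

open import Data.Nat using (ℕ; zero; suc; _≤_)
open import Data.List using (List; []; _∷_; _++_; length; replicate; concat)
open import Data.Product using (Σ; _×_)
open import Data.Sum using (_⊎_)
open import Relation.Binary.PropositionalEquality using (_≡_)
open import Relation.Nullary using (¬_)

data Tri : Set where
  t0 t1 t2 : Tri

Word : Set
Word = List Tri

#1 : Word → ℕ
#1 []        = 0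
#1 (t1 ∷ w) = suc (#1 w)
#1 (_ ∷ w)  = #1 w

#2 : Word → ℕ
#2 []        = 0
#2 (t2 ∷ w) = suc (#2 w)
#2 (_ ∷ w)  = #2 w

IsMotzkin : Word → Set
IsMotzkin w = (#1 w ≡ #2 w) × (∀ u v → w ≡ u ++ v → #2 u ≤ #1 u)

InM : Word → Set
InM w = (w ≡ t0 ∷ []) ⊎ (Σ Word λ v → (w ≡ t1 ∷ v) × IsMotzkin w)

data _<T_ : Tri → Tri → Set where
  0<1 : t0 <T t1
  0<2 : t0 <T t2
  1<2 : t1 <T t2

data _<L_ : Word → Word → Set where
  here  : ∀ {x y xs ys} → x <T y → (x ∷ xs) <L (y ∷ ys)
  there : ∀ {x xs ys} → xs <L ys → (x ∷ xs) <L (x ∷ ys)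

_≺_ : Word → Word → Set
u ≺ v = (length u Data.Nat.< length v) ⊎ ((length u ≡ length v) × (u <L v))

-- v = Succ(w): v is the next word of 𝓜 after w in the order ≺,
-- and it has the same length as w (so w is not the largest of its length).
IsSucc : Word → Word → Set
IsSucc w v = InM v × (length v ≡ length w) × (w ≺ v)
           × (∀ u → InM u → w ≺ u → ¬ (u ≺ v))

_^^_ : Word → ℕ → Word
x ^^ j = concat (replicate j x)

-- Read a string as a walk in which 1 steps up, 2 steps down and 0 stays level: a
-- string is Motzkin iff its walk from height 0 stays nonnegative and ends at 0. So if
-- p ends at height h, the words p·c of 𝓜 are exactly those whose walk c from h ends
-- at 0, and Succ(p·s) = p·s' once s' is the lexicographically next string of its
-- length after s with that property. In each case s = a 2^k x and s' = b 0^m 2^n,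
-- where x is empty or the lexicographically largest Motzkin string of its length,
-- (12)^l or (12)^l 0, and b is the letter after a (in (i) b = 2, because after 0 1 the
-- walk is too high to close). A string strictly between s and s' either begins with a
-- and lies above 2^k x, which no closing walk does, or begins with b and lies below
-- 0^m 2^n, the least string descending n levels in its length.
module Submission where

open import Defs
open import Data.Nat using (ℕ; zero; suc; _≤_; _<_; _+_; _*_; _∸_; z≤n; s≤s)
open import Data.Nat.Properties
open import Data.List using (List; []; _∷_; _++_; length)
open import Data.List.Properties using (∷-injective; ∷-injectiveʳ; length-++; ++-conicalʳ)
open import Data.Maybe using (Maybe; just; nothing)
open import Data.Product using (_×_; _,_; proj₁; proj₂; ∃-syntax)
open import Data.Sum using (inj₁; inj₂)
open import Data.Empty using (⊥-elim)
open import Relation.Binary.PropositionalEquality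
open import Relation.Nullary using (¬_)

walk : ℕ → Word → Maybe ℕ
walk d       []       = just d
walk d       (t0 ∷ w) = walk d w
walk d       (t1 ∷ w) = walk (suc d) w
walk zero    (t2 ∷ w) = nothing
walk (suc d) (t2 ∷ w) = walk d w

PrefixBounded : ℕ → Word → Set
PrefixBounded d w = ∀ u v → w ≡ u ++ v → #2 u ≤ d + #1 u

prefixBounded-∷ : ∀ {a d w} → (∀ u v → w ≡ u ++ v → #2 (a ∷ u) ≤ d + #1 (a ∷ u))
                → PrefixBounded d (a ∷ w)
prefixBounded-∷ bound []      v _  = z≤n
prefixBounded-∷ bound (_ ∷ u) v eq with ∷-injective eq
... | refl , eq′ = bound u v eq′

prefixBounded-∷⁻ : ∀ {a d w} → PrefixBounded d (a ∷ w)
                 → ∀ u v → w ≡ u ++ v → #2 (a ∷ u) ≤ d + #1 (a ∷ u)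
prefixBounded-∷⁻ {a} bound u v eq = bound (a ∷ u) v (cong (a ∷_) eq)

walk-balance : ∀ {d e} w → walk d w ≡ just e → d + #1 w ≡ e + #2 w
walk-balance     []       refl = refl
walk-balance     (t0 ∷ w) eq   = walk-balance w eq
walk-balance {d} (t1 ∷ w) eq   = trans (+-suc d _) (walk-balance w eq)
walk-balance {suc d} {e} (t2 ∷ w) eq = trans (cong suc (walk-balance w eq)) (sym (+-suc e _))

walk-prefixBounded : ∀ {d e} w → walk d w ≡ just e → PrefixBounded d w
walk-prefixBounded []       eq [] v _ = z≤n
walk-prefixBounded (t0 ∷ w) eq = prefixBounded-∷ (walk-prefixBounded w eq)
walk-prefixBounded {d} (t1 ∷ w) eq = prefixBounded-∷ λ u v eq′ →
  subst (#2 u ≤_) (sym (+-suc d (#1 u))) (walk-prefixBounded w eq u v eq′)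
walk-prefixBounded {suc d} (t2 ∷ w) eq = prefixBounded-∷ λ u v eq′ →
  s≤s (walk-prefixBounded w eq u v eq′)

walk-complete : ∀ {d e} w → d + #1 w ≡ e + #2 w → PrefixBounded d w → walk d w ≡ just e
walk-complete {d} {e} [] balance _ = cong just (+-cancelʳ-≡ 0 d e balance)
walk-complete (t0 ∷ w) balance bound = walk-complete w balance (prefixBounded-∷⁻ bound)
walk-complete {d} (t1 ∷ w) balance bound =
  walk-complete w (trans (sym (+-suc d _)) balance) λ u v eq →
    subst (#2 u ≤_) (+-suc d (#1 u)) (prefixBounded-∷⁻ bound u v eq)
walk-complete {zero} (t2 ∷ w) _ bound with bound (t2 ∷ []) w refl
... | ()
walk-complete {suc d} {e} (t2 ∷ w) balance bound =
  walk-complete w (suc-injective (trans balance (+-suc e _))) λ u v eq →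
    ≤-pred (prefixBounded-∷⁻ bound u v eq)

IsMotzkin⇒walk : ∀ {w} → IsMotzkin w → walk 0 w ≡ just 0
IsMotzkin⇒walk {w} (balance , bound) = walk-complete w balance bound

walk⇒IsMotzkin : ∀ {w} → walk 0 w ≡ just 0 → IsMotzkin w
walk⇒IsMotzkin {w} eq = walk-balance w eq , walk-prefixBounded w eq

walk-height-unique : ∀ {d d′ e} w → walk d w ≡ just e → walk d′ w ≡ just e → d ≡ d′
walk-height-unique {d} {d′} w eq eq′ =
  +-cancelʳ-≡ (#1 w) d d′ (trans (walk-balance w eq) (sym (walk-balance w eq′)))

walk-++ : ∀ {d e} x {y} → walk d x ≡ just e → walk d (x ++ y) ≡ walk e y
walk-++ []       refl = refl
walk-++ (t0 ∷ x) eq   = walk-++ x eq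
walk-++ (t1 ∷ x) eq   = walk-++ x eq
walk-++ {suc d} (t2 ∷ x) eq = walk-++ x eq

walk-++⁻ : ∀ {d f} x {y} → walk d (x ++ y) ≡ just f → ∃[ e ] walk d x ≡ just e × walk e y ≡ just f
walk-++⁻ {d} [] eq = d , refl , eq
walk-++⁻ (t0 ∷ x) eq = walk-++⁻ x eq
walk-++⁻ (t1 ∷ x) eq = walk-++⁻ x eq
walk-++⁻ {suc d} (t2 ∷ x) eq = walk-++⁻ x eq

walk-too-high : ∀ {d} y → length y < d → walk d y ≢ just 0
walk-too-high {suc d} []       _  ()
walk-too-high         (t0 ∷ y) lt = walk-too-high y (<⇒≤ lt)
walk-too-high         (t1 ∷ y) lt = walk-too-high y (<⇒≤ (m<n⇒m<1+n lt))
walk-too-high {suc d} (t2 ∷ y) lt = walk-too-high y (≤-pred lt)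

zeros twos onetwos : ℕ → Word
zeros   n = (t0 ∷ []) ^^ n
twos    n = (t2 ∷ []) ^^ n
onetwos n = (t1 ∷ t2 ∷ []) ^^ n

length-^^ : ∀ x n → length (x ^^ n) ≡ n * length x
length-^^ x zero    = refl
length-^^ x (suc n) = trans (length-++ x) (cong (length x +_) (length-^^ x n))

length-twos : ∀ n → length (twos n) ≡ n
length-twos n = trans (length-^^ _ n) (*-identityʳ n)

length-zeros : ∀ n → length (zeros n) ≡ n
length-zeros n = trans (length-^^ _ n) (*-identityʳ n)

length-zeros-++-twos : ∀ m n → length (zeros m ++ twos n) ≡ m + n
length-zeros-++-twos m n = trans (length-++ (zeros m)) (cong₂ _+_ (length-zeros m) (length-twos n))

length-twos-++ : ∀ k x → length (twos k ++ x) ≡ k + length x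
length-twos-++ k x = trans (length-++ (twos k)) (cong (_+ length x) (length-twos k))

length-onetwos : ∀ l → length (onetwos l) ≡ 2 * l
length-onetwos l = trans (length-^^ _ l) (*-comm l 2)

length-onetwos-0 : ∀ l → length (onetwos l ++ t0 ∷ []) ≡ suc (2 * l)
length-onetwos-0 l =
  trans (length-++ (onetwos l)) (trans (cong (_+ 1) (length-onetwos l)) (+-comm (2 * l) 1))

walk-zeros-++ : ∀ {d} m x → walk d (zeros m ++ x) ≡ walk d x
walk-zeros-++ zero    x = refl
walk-zeros-++ (suc m) x = walk-zeros-++ m x

walk-twos : ∀ n → walk n (twos n) ≡ just 0
walk-twos zero    = refl
walk-twos (suc n) = walk-twos n

walk-twos-++ : ∀ k x → walk k (twos k ++ x) ≡ walk 0 x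
walk-twos-++ zero    x = refl
walk-twos-++ (suc k) x = walk-twos-++ k x

walk-onetwos : ∀ {d} l → walk d (onetwos l) ≡ just d
walk-onetwos zero    = refl
walk-onetwos (suc l) = walk-onetwos l

NoneAbove NoneBelow : ℕ → Word → Set
NoneAbove d x = ∀ y → length y ≡ length x → x <L y → walk d y ≢ just 0
NoneBelow d x = ∀ y → length y ≡ length x → y <L x → walk d y ≢ just 0

LexMaxMotzkin : Word → Set
LexMaxMotzkin x = walk 0 x ≡ just 0 × NoneAbove 0 x

twos-maximal : ∀ n {y} → ¬ (twos n <L y)
twos-maximal (suc n) (here ())
twos-maximal (suc n) (there lt) = twos-maximal n lt

twos-++-noneAbove : ∀ k {x} → NoneAbove 0 x → NoneAbove k (twos k ++ x)
twos-++-noneAbove zero    above = above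
twos-++-noneAbove (suc k) above (t2 ∷ y) len (there lt) =
  twos-++-noneAbove k above y (suc-injective len) lt

twos-noneBelow : ∀ n → NoneBelow n (twos n)
twos-noneBelow (suc n) (t0 ∷ y) len (here 0<2) =
  walk-too-high y (s≤s (≤-reflexive (trans (suc-injective len) (length-twos n))))
twos-noneBelow (suc n) (t1 ∷ y) len (here 1<2) =
  walk-too-high y (m<n⇒m<1+n (s≤s (≤-reflexive (trans (suc-injective len) (length-twos n)))))
twos-noneBelow (suc n) (t2 ∷ y) len (there lt) = twos-noneBelow n y (suc-injective len) lt

zeros-++-twos-noneBelow : ∀ m n → NoneBelow n (zeros m ++ twos n)
zeros-++-twos-noneBelow zero    n = twos-noneBelow n
zeros-++-twos-noneBelow (suc m) n (t0 ∷ y) len (there lt) =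
  zeros-++-twos-noneBelow m n y (suc-injective len) lt

onetwos-noneAbove : ∀ l → NoneAbove 0 (onetwos l)
onetwos-noneAbove (suc l) (t2 ∷ _) _ (here 1<2) ()
onetwos-noneAbove (suc l) (t1 ∷ t2 ∷ y) len (there (there lt)) =
  onetwos-noneAbove l y (suc-injective (suc-injective len)) lt

onetwos-0-noneAbove : ∀ l → NoneAbove 0 (onetwos l ++ t0 ∷ [])
onetwos-0-noneAbove zero (t1 ∷ []) _ (here 0<1) ()
onetwos-0-noneAbove (suc l) (t2 ∷ _) _ (here 1<2) ()
onetwos-0-noneAbove (suc l) (t1 ∷ t2 ∷ y) len (there (there lt)) =
  onetwos-0-noneAbove l y (suc-injective (suc-injective len)) lt

onetwos-lexMaxMotzkin : ∀ l → LexMaxMotzkin (onetwos l)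
onetwos-lexMaxMotzkin l = walk-onetwos l , onetwos-noneAbove l

onetwos-0-lexMaxMotzkin : ∀ l → LexMaxMotzkin (onetwos l ++ t0 ∷ [])
onetwos-0-lexMaxMotzkin l = walk-++ (onetwos l) (walk-onetwos l) , onetwos-0-noneAbove l

<L-nonemptyˡ : ∀ {a b} → a <L b → a ≢ []
<L-nonemptyˡ (here _)  ()
<L-nonemptyˡ (there _) ()

<L-nonemptyʳ : ∀ {a b} → a <L b → b ≢ []
<L-nonemptyʳ (here _)  ()
<L-nonemptyʳ (there _) ()

<L-++ : ∀ p {a b} → a <L b → (p ++ a) <L (p ++ b)
<L-++ []      lt = lt
<L-++ (_ ∷ p) lt = there (<L-++ p lt)

<T-asym : ∀ {x y} → x <T y → ¬ (y <T x)
<T-asym 0<1 ()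
<T-asym 0<2 ()
<T-asym 1<2 ()

<T-irrefl : ∀ {x} → ¬ (x <T x)
<T-irrefl ()

<L-between-++ : ∀ p {a b u} → (p ++ a) <L u → u <L (p ++ b) → ∃[ c ] u ≡ p ++ c × a <L c × c <L b
<L-between-++ []      {u = u} lo hi = u , refl , lo , hi
<L-between-++ (_ ∷ p) (here lo)  (here hi)  = ⊥-elim (<T-asym lo hi)
<L-between-++ (_ ∷ p) (here lo)  (there _)  = ⊥-elim (<T-irrefl lo)
<L-between-++ (_ ∷ p) (there _)  (here hi)  = ⊥-elim (<T-irrefl hi)
<L-between-++ (_ ∷ p) (there lo) (there hi) with <L-between-++ p lo hi
... | c , refl , a<c , c<b = c , refl , a<c , c<b

≺-between : ∀ {u v w} → length w ≡ length u → u ≺ v → v ≺ w → length v ≡ length u × u <L v × v <L w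
≺-between eq (inj₁ u<v) (inj₁ v<w) = ⊥-elim (<-irrefl (sym eq) (<-trans u<v v<w))
≺-between eq (inj₁ u<v) (inj₂ (v≡w , _)) = ⊥-elim (<-irrefl (sym (trans v≡w eq)) u<v)
≺-between eq (inj₂ (u≡v , _)) (inj₁ v<w) = ⊥-elim (<-irrefl (trans (sym u≡v) (sym eq)) v<w)
≺-between eq (inj₂ (u≡v , u<v)) (inj₂ (_ , v<w)) = sym u≡v , u<v , v<w

InM-++⁻ : ∀ p s → p ≢ [] → s ≢ [] → InM (p ++ s)
        → IsMotzkin (p ++ s) × (∀ t → IsMotzkin (p ++ t) → InM (p ++ t))
InM-++⁻ []      s p≢[] _    _ = ⊥-elim (p≢[] refl)
InM-++⁻ (_ ∷ p) s _    s≢[] (inj₁ eq) = ⊥-elim (s≢[] (++-conicalʳ p s (∷-injectiveʳ eq)))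
InM-++⁻ (_ ∷ p) s _    _    (inj₂ (_ , eq , mot)) with ∷-injective eq
... | refl , _ = mot , λ t mot′ → inj₂ (p ++ t , refl , mot′)

length-++-cancelˡ : ∀ p {a b : Word} → length (p ++ a) ≡ length (p ++ b) → length a ≡ length b
length-++-cancelˡ p eq =
  +-cancelˡ-≡ (length p) _ _ (trans (sym (length-++ p)) (trans eq (length-++ p)))

record NextSuffix (s s′ : Word) : Set where
  field
    height      : ℕ
    walk-s      : walk height s ≡ just 0
    walk-s′     : walk height s′ ≡ just 0
    same-length : length s ≡ length s′
    s<s′        : s <L s′
    gap         : ∀ c → length c ≡ length s → s <L c → c <L s′ → walk height c ≢ just 0

IsSucc-++ : ∀ {s s′} p → p ≢ [] → InM (p ++ s) → NextSuffix s s′ → IsSucc (p ++ s) (p ++ s′)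
IsSucc-++ {s} {s′} p p≢[] ps∈M next =
  ps′∈M , sym length-ps≡ps′ , inj₂ (length-ps≡ps′ , <L-++ p s<s′) , nothing-between
  where
  open NextSuffix next
  ps-split = InM-++⁻ p s p≢[] (<L-nonemptyˡ s<s′) ps∈M

  walk-p : walk 0 p ≡ just height
  walk-p with walk-++⁻ p (IsMotzkin⇒walk (proj₁ ps-split))
  ... | d , walk-p≡d , walk-s≡0 with walk-height-unique s walk-s≡0 walk-s
  ...   | refl = walk-p≡d

  length-ps≡ps′ : length (p ++ s) ≡ length (p ++ s′)
  length-ps≡ps′ = trans (length-++ p) (trans (cong (length p +_) same-length) (sym (length-++ p)))

  ps′∈M : InM (p ++ s′)
  ps′∈M = proj₂ ps-split s′ (walk⇒IsMotzkin (trans (walk-++ p walk-p) walk-s′))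

  nothing-between : ∀ u → InM u → (p ++ s) ≺ u → ¬ (u ≺ (p ++ s′))
  nothing-between u u∈M ps≺u u≺ps′ with ≺-between (sym length-ps≡ps′) ps≺u u≺ps′
  ... | length-u , lo , hi with <L-between-++ p lo hi
  ...   | c , refl , s<c , c<s′ =
    gap c (length-++-cancelˡ p length-u) s<c c<s′
      (trans (sym (walk-++ p walk-p))
             (IsMotzkin⇒walk (proj₁ (InM-++⁻ p c p≢[] (<L-nonemptyʳ s<c) u∈M))))

nextSuffix-02 : ∀ k → NextSuffix (t0 ∷ twos (suc k)) (t2 ∷ t0 ∷ twos k)
nextSuffix-02 k = record
  { height      = suc k
  ; walk-s      = walk-twos k
  ; walk-s′     = walk-twos k
  ; same-length = refl
  ; s<s′        = here 0<2
  ; gap         = gap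
  }
  where
  gap : ∀ c → length c ≡ length (t0 ∷ twos (suc k)) → (t0 ∷ twos (suc k)) <L c
      → c <L (t2 ∷ t0 ∷ twos k) → walk (suc k) c ≢ just 0
  gap (t0 ∷ c) _   (there above) _ = ⊥-elim (twos-maximal (suc k) above)
  gap (t1 ∷ c) len _ _ =
    walk-too-high c (s≤s (≤-reflexive (trans (suc-injective len) (length-twos (suc k)))))
  gap (t2 ∷ c) len _ (there below) = zeros-++-twos-noneBelow 1 k c (suc-injective len) below
  gap (t0 ∷ c) _   (here ()) _
  gap (t2 ∷ c) _   _ (here ())

nextSuffix-01 : ∀ k m {x} → LexMaxMotzkin x → length x ≡ suc m
              → NextSuffix (t0 ∷ twos k ++ x) (t1 ∷ zeros m ++ twos (k + 1))
nextSuffix-01 k m {x} (walk-x , x-max) length-x rewrite +-comm k 1 = record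
  { height      = k
  ; walk-s      = trans (walk-twos-++ k x) walk-x
  ; walk-s′     = trans (walk-zeros-++ m (twos (suc k))) (walk-twos (suc k))
  ; same-length = cong suc same-length
  ; s<s′        = here 0<1
  ; gap         = gap
  }
  where
  open ≡-Reasoning
  same-length : length (twos k ++ x) ≡ length (zeros m ++ twos (suc k))
  same-length = begin
    length (twos k ++ x)             ≡⟨ length-twos-++ k x ⟩
    k + length x                     ≡⟨ cong (k +_) length-x ⟩
    k + suc m                        ≡⟨ +-comm k (suc m) ⟩
    suc (m + k)                      ≡⟨ +-suc m k ⟨
    m + suc k                        ≡⟨ length-zeros-++-twos m (suc k) ⟨
    length (zeros m ++ twos (suc k)) ∎

  gap : ∀ c → length c ≡ length (t0 ∷ twos k ++ x) → (t0 ∷ twos k ++ x) <L c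
      → c <L (t1 ∷ zeros m ++ twos (suc k)) → walk k c ≢ just 0
  gap (t0 ∷ c) len (there above) _ = twos-++-noneAbove k x-max c (suc-injective len) above
  gap (t1 ∷ c) len _ (there below) =
    zeros-++-twos-noneBelow m (suc k) c (trans (suc-injective len) same-length) below
  gap (t0 ∷ c) _   (here ()) _
  gap (t1 ∷ c) _   _ (here ())
  gap (t2 ∷ c) _   _ (here ())

nextSuffix-12 : ∀ k m {x} → LexMaxMotzkin x → 2 + length x ≡ m
              → NextSuffix (t1 ∷ twos (2 + k) ++ x) (t2 ∷ zeros m ++ twos k)
nextSuffix-12 k m {x} (walk-x , x-max) length-x = record
  { height      = suc k
  ; walk-s      = trans (walk-twos-++ (2 + k) x) walk-x
  ; walk-s′     = trans (walk-zeros-++ m (twos k)) (walk-twos k)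
  ; same-length = cong suc same-length
  ; s<s′        = here 1<2
  ; gap         = gap
  }
  where
  open ≡-Reasoning
  same-length : length (twos (2 + k) ++ x) ≡ length (zeros m ++ twos k)
  same-length = begin
    length (twos (2 + k) ++ x)   ≡⟨ length-twos-++ (2 + k) x ⟩
    2 + k + length x             ≡⟨ cong (2 +_) (+-comm k (length x)) ⟩
    2 + length x + k             ≡⟨ cong (_+ k) length-x ⟩
    m + k                        ≡⟨ length-zeros-++-twos m k ⟨
    length (zeros m ++ twos k)   ∎

  gap : ∀ c → length c ≡ length (t1 ∷ twos (2 + k) ++ x) → (t1 ∷ twos (2 + k) ++ x) <L c
      → c <L (t2 ∷ zeros m ++ twos k) → walk (suc k) c ≢ just 0
  gap (t1 ∷ c) len (there above) _ = twos-++-noneAbove (2 + k) x-max c (suc-injective len) above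
  gap (t2 ∷ c) len _ (there below) =
    zeros-++-twos-noneBelow m k c (trans (suc-injective len) same-length) below
  gap (t0 ∷ c) _   (here ()) _
  gap (t1 ∷ c) _   (here ()) _
  gap (t2 ∷ c) _   _ (here ())

mainTheorem5 :
    (∀ (w p : Word) (k : ℕ) → InM w → p ≢ [] → 1 ≤ k
      → w ≡ p ++ ((t0 ∷ []) ++ ((t2 ∷ []) ^^ k))
      → IsSucc w (p ++ ((t2 ∷ t0 ∷ []) ++ ((t2 ∷ []) ^^ (k ∸ 1)))))
    ×
    (∀ (w p : Word) (k l : ℕ) → InM w → p ≢ [] → 1 ≤ l
      → w ≡ p ++ ((t0 ∷ []) ++ (((t2 ∷ []) ^^ k) ++ ((t1 ∷ t2 ∷ []) ^^ l)))
      → IsSucc w (p ++ ((t1 ∷ []) ++ (((t0 ∷ []) ^^ (2 * l ∸ 1)) ++ ((t2 ∷ []) ^^ (k + 1))))))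
    ×
    (∀ (w p : Word) (k l : ℕ) → InM w → p ≢ [] → 2 ≤ k
      → w ≡ p ++ ((t1 ∷ []) ++ (((t2 ∷ []) ^^ k) ++ ((t1 ∷ t2 ∷ []) ^^ l)))
      → IsSucc w (p ++ ((t2 ∷ []) ++ (((t0 ∷ []) ^^ (2 * l + 2)) ++ ((t2 ∷ []) ^^ (k ∸ 2))))))
    ×
    (∀ (w p : Word) (k l : ℕ) → InM w → p ≢ [] → 1 ≤ k + l
      → w ≡ p ++ ((t0 ∷ []) ++ (((t2 ∷ []) ^^ k) ++ (((t1 ∷ t2 ∷ []) ^^ l) ++ (t0 ∷ []))))
      → IsSucc w (p ++ ((t1 ∷ []) ++ (((t0 ∷ []) ^^ (2 * l)) ++ ((t2 ∷ []) ^^ (k + 1))))))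
    ×
    (∀ (w p : Word) (k l : ℕ) → InM w → p ≢ [] → 2 ≤ k
      → w ≡ p ++ ((t1 ∷ []) ++ (((t2 ∷ []) ^^ k) ++ (((t1 ∷ t2 ∷ []) ^^ l) ++ (t0 ∷ []))))
      → IsSucc w (p ++ ((t2 ∷ []) ++ (((t0 ∷ []) ^^ (2 * l + 3)) ++ ((t2 ∷ []) ^^ (k ∸ 2))))))
mainTheorem5 =
    (λ { _ p (suc k) w∈M p≢[] _ refl → IsSucc-++ p p≢[] w∈M (nextSuffix-02 k) })
  , (λ { _ p k (suc l) w∈M p≢[] _ refl → IsSucc-++ p p≢[] w∈M
           (nextSuffix-01 k _ (onetwos-lexMaxMotzkin (suc l))
             (trans (length-onetwos (suc l)) (sym (suc-pred (2 * suc l))))) })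
  , (λ { _ _ 1 _ _ _ (s≤s ()) _
       ; _ p (suc (suc k)) l w∈M p≢[] _ refl → IsSucc-++ p p≢[] w∈M
           (nextSuffix-12 k _ (onetwos-lexMaxMotzkin l)
             (trans (cong (2 +_) (length-onetwos l)) (+-comm 2 (2 * l)))) })
    -- (iv) holds for k = l = 0 as well, so its hypothesis k + l ≥ 1 is unused
  , (λ { _ p k l w∈M p≢[] _ refl → IsSucc-++ p p≢[] w∈M
           (nextSuffix-01 k _ (onetwos-0-lexMaxMotzkin l) (length-onetwos-0 l)) })
  , (λ { _ _ 1 _ _ _ (s≤s ()) _
       ; _ p (suc (suc k)) l w∈M p≢[] _ refl → IsSucc-++ p p≢[] w∈M
           (nextSuffix-12 k _ (onetwos-0-lexMaxMotzkin l)
             (trans (cong (2 +_) (length-onetwos-0 l)) (+-comm 3 (2 * l)))) })
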